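{- Let $A$ be a $p$-semisimple pseudo-BCI algebra and let $d_1,d_2:A\to A$ be maps each of which is both a type I and a type II implicative derivation on $A$. Define $(d_1\to d_2)(x)=d_1(x)\to d_2(x)$ and $(d_1\rightsquigarrow d_2)(x)=d_1(x)\rightsquigarrow d_2(x)$ for $x\in A$. Then $d_1\to d_2=d_2\to d_1$ and $d_1\rightsquigarrow d_2=d_2\rightsquigarrow d_1$.
   Context: A pseudo-BCI algebra is a structure $(A,\to,\rightsquigarrow,1)$ of type $(2,2,0)$ such that for all $x,y,z\in A$: $(x\to y)\rightsquigarrow[(y\to z)\rightsquigarrow(x\to z)]=1$; $(x\rightsquigarrow y)\to[(y\rightsquigarrow z)\to(x\rightsquigarrow z)]=1$; $1\to x=x$; $1\rightsquigarrow x=x$; and $x\to y=1$, $y\to x=1$ imply $x=y$. Write $x\le y$ iff $x\to y=1$. $A$ is $p$-semisimple if $x\le 1$ implies $x=1$. Put $x\Cup_1 y=(x\to y)\rightsquigarrow y$ and $x\Cup_2 y=(x\rightsquigarrow y)\to y$. A map $d:A\to A$ is a type I implicative derivation if $d(x\to y)=(x\to d(y))\Cup_2(d(x)\to y)$ and $d(x\rightsquigarrow y)=(x\rightsquigarrow d(y))\Cup_1(d(x)\rightsquigarrow y)$ for all $x,y$; it is a type II implicative derivation if $d(x\to y)=(d(x)\to y)\Cup_2(x\to d(y))$ and $d(x\rightsquigarrow y)=(d(x)\rightsquigarrow y)\Cup_1(x\rightsquigarrow d(y))$ for all $x,y$. -}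

module Defs where

open import Level using (Level; suc)
open import Relation.Binary.PropositionalEquality using (_≡_)

record PseudoBCI (a : Level) : Set (suc a) where
  infixr 5 _⇒_ _⇝_
  field
    Carrier : Set a
    _⇒_     : Carrier → Carrier → Carrier
    _⇝_     : Carrier → Carrier → Carrier
    𝟙       : Carrier
    ax1     : ∀ x y z → ((x ⇒ y) ⇝ ((y ⇒ z) ⇝ (x ⇒ z))) ≡ 𝟙
    ax2     : ∀ x y z → ((x ⇝ y) ⇒ ((y ⇝ z) ⇒ (x ⇝ z))) ≡ 𝟙
    ax3     : ∀ x → (𝟙 ⇒ x) ≡ x
    ax4     : ∀ x → (𝟙 ⇝ x) ≡ x
    ax5     : ∀ x y → (x ⇒ y) ≡ 𝟙 → (y ⇒ x) ≡ 𝟙 → x ≡ y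

module _ {a : Level} (A : PseudoBCI a) where
  open PseudoBCI A

  _≤_ : Carrier → Carrier → Set a
  x ≤ y = (x ⇒ y) ≡ 𝟙

  PSemisimple : Set a
  PSemisimple = ∀ x → x ≤ 𝟙 → x ≡ 𝟙

  _⋓₁_ : Carrier → Carrier → Carrier
  x ⋓₁ y = (x ⇒ y) ⇝ y

  _⋓₂_ : Carrier → Carrier → Carrier
  x ⋓₂ y = (x ⇝ y) ⇒ y

  TypeI : (Carrier → Carrier) → Set a
  TypeI d = (∀ x y → d (x ⇒ y) ≡ ((x ⇒ d y) ⋓₂ (d x ⇒ y)))
          × (∀ x y → d (x ⇝ y) ≡ ((x ⇝ d y) ⋓₁ (d x ⇝ y)))
    where open import Data.Product using (_×_)

  TypeII : (Carrier → Carrier) → Set a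
  TypeII d = (∀ x y → d (x ⇒ y) ≡ ((d x ⇒ y) ⋓₂ (x ⇒ d y)))
           × (∀ x y → d (x ⇝ y) ≡ ((d x ⇝ y) ⋓₁ (x ⇝ d y)))
    where open import Data.Product using (_×_)

  _⇒ᵈ_ : (Carrier → Carrier) → (Carrier → Carrier) → Carrier → Carrier
  (d₁ ⇒ᵈ d₂) x = d₁ x ⇒ d₂ x

  _⇝ᵈ_ : (Carrier → Carrier) → (Carrier → Carrier) → Carrier → Carrier
  (d₁ ⇝ᵈ d₂) x = d₁ x ⇝ d₂ x

-- In a p-semisimple pseudo-BCI algebra both unions collapse to their first
-- argument: (u ⇝ v) → v = u and (u → v) ⇝ v = u.  Hence a type I derivation
-- satisfies d (x → y) = x → d y and a type II derivation d (x → y) = d x → y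
-- (likewise for ⇝).  Then d₁ x → d₂ x = d₂ (d₁ x → x) = d₂ (d₁ (x → x))
-- = d₂ (x → d₁ x) = d₂ x → d₁ x.
module Submission where

open import Defs
open import Level using (Level)
open import Data.Product using (_×_; _,_)
open import Relation.Binary.PropositionalEquality
  using (_≡_; sym; trans; cong; subst; module ≡-Reasoning)

module PseudoBCIProperties {a : Level} (A : PseudoBCI a) where
  open PseudoBCI A

  x⇒x≡𝟙 : ∀ x → (x ⇒ x) ≡ 𝟙
  x⇒x≡𝟙 x = subst (λ t → t ≡ 𝟙) (begin
    (𝟙 ⇝ 𝟙) ⇒ ((𝟙 ⇝ x) ⇒ (𝟙 ⇝ x)) ≡⟨ cong (_⇒ ((𝟙 ⇝ x) ⇒ (𝟙 ⇝ x))) (ax4 𝟙) ⟩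
    𝟙 ⇒ ((𝟙 ⇝ x) ⇒ (𝟙 ⇝ x))       ≡⟨ ax3 _ ⟩
    (𝟙 ⇝ x) ⇒ (𝟙 ⇝ x)             ≡⟨ cong (λ t → t ⇒ t) (ax4 x) ⟩
    x ⇒ x                         ∎) (ax2 𝟙 𝟙 x)
    where open ≡-Reasoning

  x⇒[[x⇝y]⇒y]≡𝟙 : ∀ x y → (x ⇒ ((x ⇝ y) ⇒ y)) ≡ 𝟙
  x⇒[[x⇝y]⇒y]≡𝟙 x y = subst (λ t → t ≡ 𝟙) (begin
    (𝟙 ⇝ x) ⇒ ((x ⇝ y) ⇒ (𝟙 ⇝ y)) ≡⟨ cong (_⇒ ((x ⇝ y) ⇒ (𝟙 ⇝ y))) (ax4 x) ⟩
    x ⇒ ((x ⇝ y) ⇒ (𝟙 ⇝ y))       ≡⟨ cong (λ t → x ⇒ ((x ⇝ y) ⇒ t)) (ax4 y) ⟩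
    x ⇒ ((x ⇝ y) ⇒ y)             ∎) (ax2 𝟙 x y)
    where open ≡-Reasoning

  x⇝[[x⇒y]⇝y]≡𝟙 : ∀ x y → (x ⇝ ((x ⇒ y) ⇝ y)) ≡ 𝟙
  x⇝[[x⇒y]⇝y]≡𝟙 x y = subst (λ t → t ≡ 𝟙) (begin
    (𝟙 ⇒ x) ⇝ ((x ⇒ y) ⇝ (𝟙 ⇒ y)) ≡⟨ cong (_⇝ ((x ⇒ y) ⇝ (𝟙 ⇒ y))) (ax3 x) ⟩
    x ⇝ ((x ⇒ y) ⇝ (𝟙 ⇒ y))       ≡⟨ cong (λ t → x ⇝ ((x ⇒ y) ⇝ t)) (ax3 y) ⟩
    x ⇝ ((x ⇒ y) ⇝ y)             ∎) (ax1 𝟙 x y)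
    where open ≡-Reasoning

  ⇝≡𝟙⇒⇒≡𝟙 : ∀ x y → (x ⇝ y) ≡ 𝟙 → (x ⇒ y) ≡ 𝟙
  ⇝≡𝟙⇒⇒≡𝟙 x y x⇝y≡𝟙 = subst (λ t → (x ⇒ t) ≡ 𝟙) (begin
    (x ⇝ y) ⇒ y ≡⟨ cong (_⇒ y) x⇝y≡𝟙 ⟩
    𝟙 ⇒ y       ≡⟨ ax3 y ⟩
    y           ∎) (x⇒[[x⇝y]⇒y]≡𝟙 x y)
    where open ≡-Reasoning

  [x⇒y]⇝[y⇒x⇝𝟙]≡𝟙 : ∀ x y → ((x ⇒ y) ⇝ ((y ⇒ x) ⇝ 𝟙)) ≡ 𝟙
  [x⇒y]⇝[y⇒x⇝𝟙]≡𝟙 x y =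
    subst (λ t → ((x ⇒ y) ⇝ ((y ⇒ x) ⇝ t)) ≡ 𝟙) (x⇒x≡𝟙 x) (ax1 x y x)

  module _ (p-semisimple : PSemisimple A) where

    ≤⇒≡ : ∀ x y → (x ⇒ y) ≡ 𝟙 → x ≡ y
    ≤⇒≡ x y x⇒y≡𝟙 = ax5 x y x⇒y≡𝟙 (p-semisimple (y ⇒ x) (⇝≡𝟙⇒⇒≡𝟙 _ _ y⇒x⇝𝟙≡𝟙))
      where
        y⇒x⇝𝟙≡𝟙 : ((y ⇒ x) ⇝ 𝟙) ≡ 𝟙
        y⇒x⇝𝟙≡𝟙 = trans (sym (ax4 _))
          (subst (λ t → (t ⇝ ((y ⇒ x) ⇝ 𝟙)) ≡ 𝟙) x⇒y≡𝟙 ([x⇒y]⇝[y⇒x⇝𝟙]≡𝟙 x y))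

    ⋓₂-absorb : ∀ x y → _⋓₂_ A x y ≡ x
    ⋓₂-absorb x y = sym (≤⇒≡ x _ (x⇒[[x⇝y]⇒y]≡𝟙 x y))

    ⋓₁-absorb : ∀ x y → _⋓₁_ A x y ≡ x
    ⋓₁-absorb x y = sym (≤⇒≡ x _ (⇝≡𝟙⇒⇒≡𝟙 _ _ (x⇝[[x⇒y]⇝y]≡𝟙 x y)))

    module _ {d : Carrier → Carrier} where

      typeI-⇒ : TypeI A d → ∀ x y → d (x ⇒ y) ≡ (x ⇒ d y)
      typeI-⇒ (dI⇒ , _) x y = trans (dI⇒ x y) (⋓₂-absorb _ _)

      typeI-⇝ : TypeI A d → ∀ x y → d (x ⇝ y) ≡ (x ⇝ d y)
      typeI-⇝ (_ , dI⇝) x y = trans (dI⇝ x y) (⋓₁-absorb _ _)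

      typeII-⇒ : TypeII A d → ∀ x y → d (x ⇒ y) ≡ (d x ⇒ y)
      typeII-⇒ (dII⇒ , _) x y = trans (dII⇒ x y) (⋓₂-absorb _ _)

      typeII-⇝ : TypeII A d → ∀ x y → d (x ⇝ y) ≡ (d x ⇝ y)
      typeII-⇝ (_ , dII⇝) x y = trans (dII⇝ x y) (⋓₁-absorb _ _)

    module _ {d₁ d₂ : Carrier → Carrier}
             (d₁I : TypeI A d₁) (d₁II : TypeII A d₁)
             (d₂I : TypeI A d₂) (d₂II : TypeII A d₂) where

      ⇒ᵈ-comm : ∀ x → _⇒ᵈ_ A d₁ d₂ x ≡ _⇒ᵈ_ A d₂ d₁ x
      ⇒ᵈ-comm x = begin
        d₁ x ⇒ d₂ x     ≡⟨ sym (typeI-⇒ d₂I (d₁ x) x) ⟩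
        d₂ (d₁ x ⇒ x)   ≡⟨ cong d₂ (sym (typeII-⇒ d₁II x x)) ⟩
        d₂ (d₁ (x ⇒ x)) ≡⟨ cong d₂ (typeI-⇒ d₁I x x) ⟩
        d₂ (x ⇒ d₁ x)   ≡⟨ typeII-⇒ d₂II x (d₁ x) ⟩
        d₂ x ⇒ d₁ x     ∎
        where open ≡-Reasoning

      ⇝ᵈ-comm : ∀ x → _⇝ᵈ_ A d₁ d₂ x ≡ _⇝ᵈ_ A d₂ d₁ x
      ⇝ᵈ-comm x = begin
        d₁ x ⇝ d₂ x     ≡⟨ sym (typeI-⇝ d₂I (d₁ x) x) ⟩
        d₂ (d₁ x ⇝ x)   ≡⟨ cong d₂ (sym (typeII-⇝ d₁II x x)) ⟩
        d₂ (d₁ (x ⇝ x)) ≡⟨ cong d₂ (typeI-⇝ d₁I x x) ⟩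
        d₂ (x ⇝ d₁ x)   ≡⟨ typeII-⇝ d₂II x (d₁ x) ⟩
        d₂ x ⇝ d₁ x     ∎
        where open ≡-Reasoning

proposition4p12 : {a : Level} (A : PseudoBCI a) → PSemisimple A →
    (d₁ d₂ : PseudoBCI.Carrier A → PseudoBCI.Carrier A) →
    TypeI A d₁ → TypeII A d₁ → TypeI A d₂ → TypeII A d₂ →
    (∀ x → _⇒ᵈ_ A d₁ d₂ x ≡ _⇒ᵈ_ A d₂ d₁ x) × (∀ x → _⇝ᵈ_ A d₁ d₂ x ≡ _⇝ᵈ_ A d₂ d₁ x)
proposition4p12 A p-semisimple d₁ d₂ d₁I d₁II d₂I d₂II =
  ⇒ᵈ-comm p-semisimple d₁I d₁II d₂I d₂II , ⇝ᵈ-comm p-semisimple d₁I d₁II d₂I d₂II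
  where open PseudoBCIProperties A
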